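{- For every integer $n\geq1$, $n$ is a power of $2$ (including $n=1$) if and only if $\langle\!\langle n\rangle\!\rangle_{2}=ab$.
   Context: For $n\geq1$, let $D_n$ be the set of divisors of $n$, $2D_n=\{2d:d\in D_n\}$, and $u_1<\dots<u_k$ the elements of the symmetric difference $D_n\triangle 2D_n$; the word $\langle\!\langle n\rangle\!\rangle_{2}=w_1\cdots w_k\in\{a,b\}^{\ast}$ has $w_i=a$ if $u_i\in D_n\setminus2D_n$ and $w_i=b$ if $u_i\in2D_n\setminus D_n$. -}

module Defs where

open import Data.Nat using (ℕ; zero; suc; _+_; _*_; _^_; _≤_; s≤s; z≤n)
open import Data.Nat.Divisibility using (_∣_; _∣?_)
open import Data.List using (List; []; _∷_; _++_; upTo)
open import Data.Product using (∃; _×_; _,_; proj₁; proj₂)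
open import Relation.Nullary using (Dec; yes; no; ¬_)
open import Relation.Binary.PropositionalEquality using (_≡_; refl; cong; sym; subst)
open import Data.Nat.Properties using (_≟_; m<n⇒m<1+n; n<1+n; m≤n⇒m<n∨m≡n; ≤-pred; m≤m+n)
open import Data.Sum using (inj₁; inj₂)
open import Data.Empty using (⊥)
open import Data.Nat using (_<_)

data Letter : Set where
  a b : Letter

InD : ℕ → ℕ → Set
InD n u = u ∣ n

In2D : ℕ → ℕ → Set
In2D n u = ∃ λ d → u ≡ 2 * d × d ∣ n

-- Decision procedure for membership in 2D_n (search over d ≤ u suffices).
private
  search : (n u k : ℕ) → Dec (∃ λ d → d < k × u ≡ 2 * d × d ∣ n)
  search n u zero = no λ { (d , () , _) }
  search n u (suc k) with search n u k
  ... | yes (d , d<k , e , p) = yes (d , m<n⇒m<1+n d<k , e , p)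
  ... | no ¬r with u ≟ 2 * k | k ∣? n
  ...   | yes e | yes p = yes (k , n<1+n k , e , p)
  ...   | yes e | no ¬p = no λ { (d , d<sk , e' , p') → helper d d<sk e' p' e ¬p }
    where
    helper : ∀ d → d < suc k → u ≡ 2 * d → d ∣ n → u ≡ 2 * k → ¬ (k ∣ n) → ⊥
    helper d d<sk e' p' e ¬p with m≤n⇒m<n∨m≡n (≤-pred d<sk)
    ... | inj₁ d<k = ¬r (d , d<k , e' , p')
    ... | inj₂ refl = ¬p p'
  ...   | no ¬e | _ = no λ { (d , d<sk , e' , p') → helper d d<sk e' p' }
    where
    helper : ∀ d → d < suc k → u ≡ 2 * d → d ∣ n → ⊥
    helper d d<sk e' p' with m≤n⇒m<n∨m≡n (≤-pred d<sk)
    ... | inj₁ d<k = ¬r (d , d<k , e' , p')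
    ... | inj₂ refl = ¬e e'

in2D? : (n u : ℕ) → Dec (In2D n u)
in2D? n u with search n u (suc u)
... | yes (d , _ , e , p) = yes (d , e , p)
... | no ¬r = no λ { (d , e , p) → ¬r (d , bound d e , e , p) }
  where
  bound : ∀ d → u ≡ 2 * d → d < suc u
  bound d refl = s≤s (m≤m+n d (d + 0))

letterAt : ℕ → ℕ → List Letter
letterAt n u with u ∣? n | in2D? n u
... | yes _ | no _  = a ∷ []
... | no _  | yes _ = b ∷ []
... | _     | _     = []

scan : ℕ → ℕ → List Letter
scan n zero = []
scan n (suc m) = scan n m ++ letterAt n (suc m)

-- ⟪ n ⟫₂ : the word w₁⋯w_k read off from the elements u₁ < ⋯ < u_k of
-- D_n △ 2D_n.  For n ≥ 1 every element of D_n ∪ 2D_n lies in [1, 2n],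
-- so scanning u = 1..2n in increasing order lists them in order.
word₂ : ℕ → List Letter
word₂ n = scan n (2 * n)

-- Both sides of the equivalence are equivalent to "n has no odd divisor other than 1".
-- For such n the only u in D_n △ 2D_n are u = 1 (letter a) and u = 2n (letter b): a divisor
-- u > 1 of n is even, so u ∈ 2D_n, and an element 2d < 2n of 2D_n has an even cofactor
-- n / d, so 2d ∣ n.  Conversely an odd divisor u > 1 of n lies in D_n ∖ 2D_n just like
-- u = 1, so the word contains a twice.
module Submission where

open import Defs
open import Data.Nat using (ℕ; _≥_; _^_)
open import Data.List using (List; []; _∷_)
open import Data.Product using (∃)
open import Relation.Binary.PropositionalEquality using (_≡_)
open import Function.Bundles using (_⇔_)

open import Data.Nat using (zero; suc; _+_; _*_; _∸_; _<_; _≤_; _≤′_; ≤′-refl; ≤′-step; s≤s; z≤n)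
open import Data.Nat.Properties
  using (even≢odd; *-assoc; *-distribˡ-+; *-cancelˡ-≡; *-cancelˡ-<; *-identityˡ; m≤m+n; m<m+n; m≤n+m; ≤-trans; ≤-refl; <-irrefl; <-≤-trans; m≤n⇒m≤1+n; ≤⇒≤′; ≤′⇒≤)
open import Data.Nat.Divisibility using (_∣_; divides; _∣?_; ∣-refl; ∣-trans; ∣1⇒≡1; ∣⇒≤; m∣m*n; n∣m*n; ∣n⇒∣m*n; *-monoʳ-∣; 1∣_)
open import Data.Nat.Induction using (<-wellFounded)
open import Induction.WellFounded using (Acc; acc)
open import Data.List using (_++_)
open import Data.List.Properties using (++-identityʳ; ++-assoc)
open import Data.Product using (Σ; _,_)
open import Relation.Nullary using (¬_; yes; no; contradiction)
open import Relation.Binary.PropositionalEquality using (_≢_; refl; sym; trans; cong; cong₂; subst; module ≡-Reasoning)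
open import Function.Bundles using (mk⇔; module Equivalence)

data EvenOrOdd : ℕ → Set where
  even : ∀ m → EvenOrOdd (2 * m)
  odd  : ∀ m → EvenOrOdd (suc (2 * m))

evenOrOdd : ∀ n → EvenOrOdd n
evenOrOdd zero = even 0
evenOrOdd (suc n) with evenOrOdd n
... | even m = odd m
... | odd m = subst EvenOrOdd (*-distribˡ-+ 2 1 m) (even (suc m))

odd∣2*⇒∣ : ∀ c x → suc (2 * c) ∣ 2 * x → suc (2 * c) ∣ x
odd∣2*⇒∣ c x (divides q 2x≡qd) with evenOrOdd q
... | even q′ = divides q′ (*-cancelˡ-≡ x (q′ * d) 2 (trans 2x≡qd (*-assoc 2 q′ d)))
  where d = suc (2 * c)
... | odd q′ = contradiction (trans 2x≡qd (cong suc 2c+2q′d≡2[c+q′d])) (even≢odd x (c + q′ * d))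
  where
  open ≡-Reasoning
  d = suc (2 * c)
  2c+2q′d≡2[c+q′d] : 2 * c + 2 * q′ * d ≡ 2 * (c + q′ * d)
  2c+2q′d≡2[c+q′d] = begin
    2 * c + 2 * q′ * d   ≡⟨ cong (2 * c +_) (*-assoc 2 q′ d) ⟩
    2 * c + 2 * (q′ * d) ≡⟨ *-distribˡ-+ 2 c (q′ * d) ⟨
    2 * (c + q′ * d)     ∎

NoOddDivisor : ℕ → Set
NoOddDivisor n = ∀ m → suc (2 * m) ∣ n → m ≡ 0

noOddDivisor-1 : NoOddDivisor 1
noOddDivisor-1 m d∣1 with ∣1⇒≡1 d∣1
noOddDivisor-1 zero _ | refl = refl

noOddDivisor-2* : ∀ {n} → NoOddDivisor n → NoOddDivisor (2 * n)
noOddDivisor-2* {n} noOdd m d∣2n = noOdd m (odd∣2*⇒∣ m n d∣2n)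

noOddDivisor-/2 : ∀ {n} → NoOddDivisor (2 * n) → NoOddDivisor n
noOddDivisor-/2 noOdd m d∣n = noOdd m (∣n⇒∣m*n 2 d∣n)

noOddDivisor-2^ : ∀ k → NoOddDivisor (2 ^ k)
noOddDivisor-2^ zero    = noOddDivisor-1
noOddDivisor-2^ (suc k) = noOddDivisor-2* (noOddDivisor-2^ k)

noOddDivisor⇒2^ : ∀ {n} → n ≥ 1 → NoOddDivisor n → ∃ λ k → n ≡ 2 ^ k
noOddDivisor⇒2^ {n} = go n (<-wellFounded n)
  where
  go : ∀ n → Acc _<_ n → n ≥ 1 → NoOddDivisor n → ∃ λ k → n ≡ 2 ^ k
  go n _ _ noOdd with evenOrOdd n
  go _ _ _ noOdd | odd m with noOdd m ∣-refl
  ... | refl = 0 , refl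
  go _ (acc rec) _ noOdd | even (suc m) with go (suc m) (rec (m<m+n (suc m) (s≤s z≤n))) (s≤s z≤n) (noOddDivisor-/2 noOdd)
  ... | k , m≡2^k = suc k , cong (2 *_) m≡2^k

noOddDivisor⇒∣⇒even : ∀ {n c} → NoOddDivisor n → c ∣ n → c ≢ 1 → ∃ λ h → c ≡ 2 * h
noOddDivisor⇒∣⇒even {c = c} noOdd c∣n c≢1 with evenOrOdd c
... | even h = h , refl
... | odd m with noOdd m c∣n
...   | refl = contradiction refl c≢1

noOddDivisor⇒2*∣ : ∀ {n d} → NoOddDivisor n → d ∣ n → d < n → 2 * d ∣ n
noOddDivisor⇒2*∣ {n} {d} noOdd (divides c n≡cd) d<n
  with noOddDivisor⇒∣⇒even noOdd (subst (c ∣_) (sym n≡cd) (m∣m*n d)) c≢1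
  where
  c≢1 : c ≢ 1
  c≢1 refl = <-irrefl (sym (trans n≡cd (*-identityˡ d))) d<n
... | h , refl = subst (2 * d ∣_) (sym (trans n≡cd (*-assoc 2 h d))) (*-monoʳ-∣ 2 (n∣m*n h))

odd∉2D : ∀ {n} m → ¬ In2D n (suc (2 * m))
odd∉2D m (d , odd≡2d , _) = even≢odd d m (sym odd≡2d)

letterAt-a : ∀ {n u} → u ∣ n → ¬ In2D n u → letterAt n u ≡ a ∷ []
letterAt-a {n} {u} u∣n u∉2D with u ∣? n | in2D? n u
... | yes _   | no _     = refl
... | no u∤n  | _        = contradiction u∣n u∤n
... | yes _   | yes u∈2D = contradiction u∈2D u∉2D

letterAt-b : ∀ {n u} → ¬ u ∣ n → In2D n u → letterAt n u ≡ b ∷ []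
letterAt-b {n} {u} u∤n u∈2D with u ∣? n | in2D? n u
... | no _    | yes _    = refl
... | yes u∣n | _        = contradiction u∣n u∤n
... | no _    | no u∉2D  = contradiction u∈2D u∉2D

letterAt-[] : ∀ {n u} → (u ∣ n ⇔ In2D n u) → letterAt n u ≡ []
letterAt-[] {n} {u} u∣n⇔u∈2D with u ∣? n | in2D? n u
... | yes _   | yes _    = refl
... | no _    | no _     = refl
... | yes u∣n | no u∉2D  = contradiction (Equivalence.to u∣n⇔u∈2D u∣n) u∉2D
... | no u∤n  | yes u∈2D = contradiction (Equivalence.from u∣n⇔u∈2D u∈2D) u∤n

letterAt-odd : ∀ {n} m → suc (2 * m) ∣ n → letterAt n (suc (2 * m)) ≡ a ∷ []
letterAt-odd m u∣n = letterAt-a u∣n (odd∉2D m)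

letterAt-2* : ∀ {n} → n ≥ 1 → letterAt n (2 * n) ≡ b ∷ []
letterAt-2* {n@(suc _)} _ = letterAt-b 2n∤n (n , refl , ∣-refl)
  where
  2n∤n : ¬ 2 * n ∣ n
  2n∤n 2n∣n = <-irrefl refl (<-≤-trans (m<m+n n (s≤s z≤n)) (∣⇒≤ 2n∣n))

noOddDivisor⇒letterAt≡[] : ∀ {n u} → NoOddDivisor n → 1 < u → u < 2 * n → letterAt n u ≡ []
noOddDivisor⇒letterAt≡[] {n} {u} noOdd 1<u u<2n = letterAt-[] (mk⇔ u∣n⇒u∈2D u∈2D⇒u∣n)
  where
  u∣n⇒u∈2D : u ∣ n → In2D n u
  u∣n⇒u∈2D u∣n with noOddDivisor⇒∣⇒even noOdd u∣n (λ { refl → <-irrefl refl 1<u })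
  ... | h , refl = h , refl , ∣-trans (n∣m*n 2) u∣n
  u∈2D⇒u∣n : In2D n u → u ∣ n
  u∈2D⇒u∣n (d , refl , d∣n) = noOddDivisor⇒2*∣ noOdd d∣n (*-cancelˡ-< 2 d n u<2n)

scan-prefix : ∀ {n m M} → m ≤′ M → ∃ λ R → scan n M ≡ scan n m ++ R
scan-prefix ≤′-refl = [] , sym (++-identityʳ _)
scan-prefix {n} {m} {suc M} (≤′-step m≤M) with scan-prefix m≤M
... | R , M≡m++R = R ++ letterAt n (suc M) ,
  trans (cong (_++ letterAt n (suc M)) M≡m++R) (++-assoc (scan n m) R _)

scan-silent : ∀ {n m M} → m ≤′ M → (∀ {u} → m < u → u ≤ M → letterAt n u ≡ []) → scan n M ≡ scan n m
scan-silent ≤′-refl _ = refl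
scan-silent {n} {m} {suc M} (≤′-step m≤M) silent = begin
  scan n M ++ letterAt n (suc M) ≡⟨ cong (scan n M ++_) (silent (s≤s (≤′⇒≤ m≤M)) ≤-refl) ⟩
  scan n M ++ []                 ≡⟨ ++-identityʳ (scan n M) ⟩
  scan n M                       ≡⟨ scan-silent m≤M (λ m<u u≤M → silent m<u (m≤n⇒m≤1+n u≤M)) ⟩
  scan n m                       ∎
  where open ≡-Reasoning

noOddDivisor⇒word₂ : ∀ {n} → n ≥ 1 → NoOddDivisor n → word₂ n ≡ a ∷ b ∷ []
noOddDivisor⇒word₂ {n@(suc p)} n≥1 noOdd = begin
  word₂ n                                  ≡⟨⟩
  scan n (2 * n ∸ 1) ++ letterAt n (2 * n) ≡⟨ cong (_++ letterAt n (2 * n)) (scan-silent (≤⇒≤′ 1≤2n∸1) silent) ⟩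
  letterAt n 1 ++ letterAt n (2 * n)       ≡⟨ cong₂ _++_ (letterAt-odd 0 (1∣ n)) (letterAt-2* n≥1) ⟩
  a ∷ b ∷ []                               ∎
  where
  open ≡-Reasoning
  1≤2n∸1 : 1 ≤ 2 * n ∸ 1
  1≤2n∸1 = ≤-trans (s≤s z≤n) (m≤n+m _ p)
  silent : ∀ {u} → 1 < u → u ≤ 2 * n ∸ 1 → letterAt n u ≡ []
  silent 1<u u≤2n∸1 = noOddDivisor⇒letterAt≡[] noOdd 1<u (s≤s u≤2n∸1)

a∷xs++a≢ab : ∀ xs ys → ((a ∷ xs) ++ a ∷ []) ++ ys ≢ a ∷ b ∷ []
a∷xs++a≢ab []          _ ()
a∷xs++a≢ab (_ ∷ [])    _ ()
a∷xs++a≢ab (_ ∷ _ ∷ _) _ ()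

word₂⇒noOddDivisor : ∀ {n} → n ≥ 1 → word₂ n ≡ a ∷ b ∷ [] → NoOddDivisor n
word₂⇒noOddDivisor _ _ zero _ = refl
word₂⇒noOddDivisor {n@(suc _)} _ w (suc m) u∣n = contradiction (trans (sym word₂≡) w) (a∷xs++a≢ab R′ R)
  where
  open ≡-Reasoning
  u = suc (2 * suc m)
  u≤2n : u ≤ 2 * n
  u≤2n = ≤-trans (∣⇒≤ u∣n) (m≤m+n n (n + 0))
  open Σ (scan-prefix {n} (≤⇒≤′ u≤2n)) renaming (proj₁ to R; proj₂ to 2n≡u++R)
  open Σ (scan-prefix {n} {1} {2 * suc m} (≤⇒≤′ (s≤s z≤n))) renaming (proj₁ to R′; proj₂ to 2m≡1++R′)
  word₂≡ : word₂ n ≡ ((a ∷ R′) ++ a ∷ []) ++ R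
  word₂≡ = begin
    word₂ n                                                ≡⟨ 2n≡u++R ⟩
    (scan n (2 * suc m) ++ letterAt n u) ++ R              ≡⟨ cong (λ xs → (xs ++ letterAt n u) ++ R) 2m≡1++R′ ⟩
    ((letterAt n 1 ++ R′) ++ letterAt n u) ++ R            ≡⟨ cong₂ (λ x y → ((x ++ R′) ++ y) ++ R)
                                                                    (letterAt-odd 0 (1∣ n)) (letterAt-odd (suc m) u∣n) ⟩
    ((a ∷ R′) ++ a ∷ []) ++ R                              ∎

lemma22 : (n : ℕ) → n ≥ 1 → ((∃ λ k → n ≡ 2 ^ k) ⇔ (word₂ n ≡ a ∷ b ∷ []))
lemma22 n n≥1 = mk⇔
  (λ { (k , refl) → noOddDivisor⇒word₂ n≥1 (noOddDivisor-2^ k) })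
  (λ w → noOddDivisor⇒2^ n≥1 (word₂⇒noOddDivisor n≥1 w))
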